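{- Let $G$ be a structured graph and $H$ a bridgeless canonical 2-edge cover of $G$. Let $S$ be a non-trivial segment of the component graph $\hat G_H$ and $A$ a node of $S$. Then $G$ contains a matching of size 3 each of whose edges joins a vertex of $V(C_A)$ to a vertex of $V(S)\setminus V(C_A)$.
   Context: A 2-edge cover of $G$ is a spanning subgraph with all degrees at least 2; bridgeless means all components are 2-edge-connected; canonical (for bridgeless covers) means each component is a cycle on $i$ vertices with $4\le i\le7$ or has at least 8 edges. The component graph $\hat G_H$ is obtained from $G$ by contracting the vertex set of each component of $H$ into a single node and deleting self-loops; $C_A$ is the component corresponding to node $A$. A non-trivial segment $S$ is a maximal 2-node-connected subgraph of $\hat G_H$ with at least 3 nodes; $V(S)$ is the set of all vertices of $G$ in the components corresponding to nodes of $S$. Structured: for $\alpha\ge1$, a 2EC subgraph $C$ of a 2EC graph $G$ is $\alpha$-contractible if every spanning 2EC subgraph of $G$ contains at least $\frac1\alpha|E(C)|$ edges with both endpoints in $V(C)$; an edge $uv$ is irrelevant if $\{u,v\}$ is a 2-vertex cut; a 2-vertex cut $\{u,v\}$ is non-isolating unless $G\setminus\{u,v\}$ has exactly two components one of which is a single vertex; a 3-vertex cut $\{u,v,w\}$ is large unless $G\setminus\{u,v,w\}$ has exactly two components one of which has at most 6 vertices. $G$ is $(\alpha,\varepsilon)$-structured if simple, without cut vertex, with at least $4/\varepsilon$ vertices, and without $\alpha$-contractible subgraphs of size at most $2/\varepsilon$, irrelevant edges, non-isolating 2-vertex cuts and large 3-vertex cuts. "Structured" means $(\frac54,\varepsilon)$-structured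 for a fixed $\varepsilon\in(0,\frac1{24}]$. -}

module Defs where

open import Data.Nat using (ℕ; zero; suc; _+_; _*_; _≤_; _<ᵇ_)
open import Data.Fin using (Fin; toℕ; _≟_)
import Data.Fin as F
open import Data.Bool using (Bool; true; false; T; _∧_; _∨_; not; if_then_else_)
open import Data.Product using (Σ; _×_; ∃; _,_; proj₁; proj₂)
open import Data.Sum using (_⊎_)
open import Relation.Nullary using (¬_; does)
open import Relation.Binary.PropositionalEquality using (_≡_; _≢_)

-- Vertex sets and edge sets over the vertex type Fin m (Bool-valued, so
-- that they can be counted).

VSet : ℕ → Set
VSet m = Fin m → Bool

-- an edge set / adjacency matrix; an (undirected) graph is a symmetric one
BGraph : ℕ → Set
BGraph m = Fin m → Fin m → Bool

_∈ₛ_ : ∀ {m} → Fin m → VSet m → Set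
x ∈ₛ S = T (S x)

_⊆ₛ_ : ∀ {m} → VSet m → VSet m → Set
S ⊆ₛ S' = ∀ x → x ∈ₛ S → x ∈ₛ S'

full : ∀ {m} → VSet m
full _ = true

_─_ : ∀ {m} → VSet m → Fin m → VSet m
(S ─ v) x = S x ∧ not (does (x ≟ v))

_∖_ : ∀ {m} → VSet m → VSet m → VSet m
(S ∖ X) x = S x ∧ not (X x)

single : ∀ {m} → Fin m → VSet m
single v x = does (x ≟ v)

card : ∀ {m} → VSet m → ℕ
card {zero}  S = 0
card {suc m} S = (if S F.zero then 1 else 0) + card (λ x → S (F.suc x))

sumFin : ∀ {m} → (Fin m → ℕ) → ℕ
sumFin {zero}  f = 0
sumFin {suc m} f = f F.zero + sumFin (λ x → f (F.suc x))

edgeCountIn : ∀ {m} → BGraph m → VSet m → ℕ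
edgeCountIn E S =
  sumFin (λ x → card (λ y → S x ∧ S y ∧ E x y ∧ (toℕ x <ᵇ toℕ y)))

_⊆ₑ_ : ∀ {m} → BGraph m → BGraph m → Set
E ⊆ₑ G = ∀ x y → T (E x y) → T (G x y)

Symmetric : ∀ {m} → BGraph m → Set
Symmetric E = ∀ x y → E x y ≡ E y x

IsSimple : ∀ {m} → BGraph m → Set
IsSimple G = Symmetric G × (∀ x → G x x ≡ false)

delEdge : ∀ {m} → BGraph m → Fin m → Fin m → BGraph m
delEdge E a b x y =
  E x y ∧ not ((does (x ≟ a) ∧ does (y ≟ b)) ∨ (does (x ≟ b) ∧ does (y ≟ a)))

rel : ∀ {m} → BGraph m → Fin m → Fin m → Set
rel E x y = T (E x y)

data ReachIn {m} (R : Fin m → Fin m → Set) (S : VSet m) : Fin m → Fin m → Set where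
  here : ∀ {x} → x ∈ₛ S → ReachIn R S x x
  step : ∀ {x y z} → x ∈ₛ S → R x y → ReachIn R S y z → ReachIn R S x z

ConnectedIn : ∀ {m} → (Fin m → Fin m → Set) → VSet m → Set
ConnectedIn R S = ∀ x y → x ∈ₛ S → y ∈ₛ S → ReachIn R S x y

TwoEC : ∀ {m} → VSet m → BGraph m → Set
TwoEC S E =
  (2 ≤ card S) × ConnectedIn (rel E) S ×
  (∀ a b → a ∈ₛ S → b ∈ₛ S → T (E a b) → ConnectedIn (rel (delEdge E a b)) S)

-- Structured graphs.  ε = p / q, α = a / b.

IsTwoECSubgraph : ∀ {n} → BGraph n → VSet n → BGraph n → Set
IsTwoECSubgraph G VC EC =
  Symmetric EC × EC ⊆ₑ G ×
  (∀ x y → T (EC x y) → x ∈ₛ VC × y ∈ₛ VC) × TwoEC VC EC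

Contractible : ∀ {n} → ℕ → ℕ → BGraph n → VSet n → BGraph n → Set
Contractible {n} a b G VC EC =
  ∀ (F : BGraph n) → Symmetric F → F ⊆ₑ G → TwoEC full F →
    b * edgeCountIn EC VC ≤ a * edgeCountIn F VC

NoCutVertex : ∀ {n} → BGraph n → Set
NoCutVertex G = ∀ v → ConnectedIn (rel G) (full ─ v)

ExactlyTwoCompsOneIs : ∀ {n} → BGraph n → VSet n → VSet n → Set
ExactlyTwoCompsOneIs G S X =
  X ⊆ₛ S × (∃ λ x → x ∈ₛ X) × (∃ λ y → y ∈ₛ (S ∖ X)) ×
  ConnectedIn (rel G) X × ConnectedIn (rel G) (S ∖ X) ×
  (∀ x y → x ∈ₛ X → y ∈ₛ (S ∖ X) → ¬ T (G x y))

TwoVertexCut : ∀ {n} → BGraph n → Fin n → Fin n → Set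
TwoVertexCut G u v = u ≢ v × ¬ ConnectedIn (rel G) ((full ─ u) ─ v)

ThreeVertexCut : ∀ {n} → BGraph n → Fin n → Fin n → Fin n → Set
ThreeVertexCut G u v w =
  u ≢ v × u ≢ w × v ≢ w × ¬ ConnectedIn (rel G) (((full ─ u) ─ v) ─ w)

NoIrrelevantEdge : ∀ {n} → BGraph n → Set
NoIrrelevantEdge G = ∀ u v → T (G u v) → ¬ TwoVertexCut G u v

NoNonIsolatingCut : ∀ {n} → BGraph n → Set
NoNonIsolatingCut G = ∀ u v → TwoVertexCut G u v →
  ∃ λ w → ExactlyTwoCompsOneIs G ((full ─ u) ─ v) (single w)

NoLargeThreeCut : ∀ {n} → BGraph n → Set
NoLargeThreeCut G = ∀ u v w → ThreeVertexCut G u v w →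
  ∃ λ X → card X ≤ 6 × ExactlyTwoCompsOneIs G (((full ─ u) ─ v) ─ w) X

-- no (a/b)-contractible subgraph with at most 2/ε = 2q/p vertices
NoSmallContractible : ∀ {n} → ℕ → ℕ → ℕ → ℕ → BGraph n → Set
NoSmallContractible a b p q G = ∀ VC EC → IsTwoECSubgraph G VC EC →
  card VC * p ≤ 2 * q → ¬ Contractible a b G VC EC

-- G is (a/b , p/q)-structured.  G is also assumed 2EC (standing
-- assumption of the paper; contractibility is defined for 2EC graphs).
AlphaEpsStructured : (n : ℕ) → ℕ → ℕ → ℕ → ℕ → BGraph n → Set
AlphaEpsStructured n a b p q G =
  IsSimple G × TwoEC full G × NoCutVertex G × (4 * q ≤ n * p) ×
  NoSmallContractible a b p q G × NoIrrelevantEdge G ×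
  NoNonIsolatingCut G × NoLargeThreeCut G

Structured : (n : ℕ) → ℕ → ℕ → BGraph n → Set
Structured n p q G = AlphaEpsStructured n 5 4 p q G

TwoEdgeCover : ∀ {n} → BGraph n → BGraph n → Set
TwoEdgeCover G H = Symmetric H × H ⊆ₑ G × (∀ x → 2 ≤ card (H x))

IsComponent : ∀ {n} → BGraph n → VSet n → Set
IsComponent H C =
  (∃ λ x → x ∈ₛ C) × ConnectedIn (rel H) C ×
  (∀ x y → x ∈ₛ C → T (H x y) → y ∈ₛ C)

Bridgeless : ∀ {n} → BGraph n → Set
Bridgeless H = ∀ C → IsComponent H C → TwoEC C H

IsCycle : ∀ {n} → BGraph n → VSet n → Set
IsCycle H C =
  ConnectedIn (rel H) C × (∀ x → x ∈ₛ C → card (λ y → H x y ∧ C y) ≡ 2)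

Canonical : ∀ {n} → BGraph n → Set
Canonical H = ∀ C → IsComponent H C →
  (IsCycle H C × 4 ≤ card C × card C ≤ 7) ⊎ (8 ≤ edgeCountIn H C)

-- Component graph.  A labelling c : Fin n → Fin k identifies the nodes of
-- the component graph with Fin k: c x ≡ c y iff x, y lie in the same
-- component of H, and every label is used.

IsComponentLabelling : ∀ {n k} → BGraph n → (Fin n → Fin k) → Set
IsComponentLabelling {n} {k} H c =
  (∀ (A : Fin k) → ∃ λ x → c x ≡ A) ×
  (∀ x y → (c x ≡ c y → ReachIn (rel H) full x y) ×
           (ReachIn (rel H) full x y → c x ≡ c y))

-- adjacency in the component graph Ĝ_H (self-loops deleted; parallel
-- edges are irrelevant for the notions used below)
CompAdj : ∀ {n k} → BGraph n → (Fin n → Fin k) → Fin k → Fin k → Set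
CompAdj G c A B = A ≢ B × ∃ λ u → ∃ λ v → c u ≡ A × c v ≡ B × T (G u v)

TwoNodeConnected : ∀ {k} → (Fin k → Fin k → Set) → VSet k → Set
TwoNodeConnected R S =
  (3 ≤ card S) × ConnectedIn R S × (∀ z → z ∈ₛ S → ConnectedIn R (S ─ z))

NonTrivialSegment : ∀ {k} → (Fin k → Fin k → Set) → VSet k → Set
NonTrivialSegment R S =
  TwoNodeConnected R S × (∀ S' → S ⊆ₛ S' → TwoNodeConnected R S' → S' ⊆ₛ S)

Matching3 : ∀ {n} → BGraph n → (Fin 3 → Fin n) → (Fin 3 → Fin n) → Set
Matching3 G u v =
  (∀ i → T (G (u i) (v i))) ×
  (∀ i j → i ≢ j → u i ≢ u j × v i ≢ v j × u i ≢ v j) ×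
  (∀ i → u i ≢ v i)

{-# OPTIONS --safe #-}
-- Every component of H has at least four vertices: it is a cycle of length at least 4 or has at
-- least 8 edges.  Call an edge of G from C_A to V(S) ∖ V(C_A) an exit.  No two vertices z₁, z₂ meet
-- all exits: removing them, together with the vertex w that {z₁, z₂} isolates if it is a cut, leaves
-- G connected, so some walk avoiding z₁, z₂, w joins C_A to another component of S.  Once this walk
-- leaves S (in the component graph) from A it can only come back to S at A, since coming back
-- anywhere else would attach an ear to S and contradict the maximality of the segment; hence the
-- walk uses an exit.  So the exits form a bipartite graph without a vertex cover of size two, and
-- König's theorem gives a matching of size three.
module Submission where

open import Defs
open import Data.Bool using (true; false; T; _∧_; _∨_; not; if_then_else_)
open import Data.Bool.Properties using (T-∧; T-∨)
open import Data.Empty using (⊥; ⊥-elim)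
open import Data.Fin using (Fin; toℕ; _≟_)
import Data.Fin as Fin
open import Data.Fin.Patterns using (0F; 1F; 2F)
open import Data.Fin.Properties using (any?)
open import Data.Nat using (ℕ; zero; suc; pred; _+_; _≤_; _<_; _*_; _<ᵇ_; _≤?_; z≤n; s≤s)
open import Data.Nat.Properties
  using (≤-trans; ≤-reflexive; n≤1+n; +-mono-≤; *-mono-≤; pred-mono-≤; ≤-pred; <⇒≤pred; ≰⇒>; <ᵇ⇒<; n≮n)
open import Data.Product using (Σ; _×_; ∃; ∃₂; _,_; proj₁; proj₂)
open import Data.Sum using (_⊎_; inj₁; inj₂)
open import Data.Unit using (⊤; tt)
open import Data.Vec using (_∷_; []; lookup)
open import Function using (_∘_)
open import Function.Bundles using (Equivalence)
open import Relation.Binary.Definitions using (DecidableEquality)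
open import Relation.Binary.PropositionalEquality using (_≡_; _≢_; refl; sym; trans; cong; subst; ≢-sym)
open import Relation.Nullary using (¬_; Dec; yes; no; does; contradiction)
open import Relation.Nullary.Decidable
  using (T?; ¬?; _×-dec_; decidable-stable; ¬¬-excluded-middle; toWitnessFalse)

open Equivalence using (to; from)

private variable
  m : ℕ
  S S' : VSet m
  a b d x z : Fin m

∁ : VSet m → VSet m
∁ S x = not (S x)

_∪_ : VSet m → VSet m → VSet m
(S ∪ S') x = S x ∨ S' x

T-does⁺ : ∀ {p} {P : Set p} (p? : Dec P) → P → T (does p?)
T-does⁺ (yes _) _ = tt
T-does⁺ (no ¬p) p = ¬p p

T-does⁻ : ∀ {p} {P : Set p} (p? : Dec P) → T (does p?) → P
T-does⁻ (yes p) _ = p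

∈-─⁺ : ∀ (S : VSet m) → x ∈ₛ S → x ≢ a → x ∈ₛ (S ─ a)
∈-─⁺ {x = x} {a = a} S x∈S x≢a with x ≟ a
... | yes x≡a = contradiction x≡a x≢a
... | no _ = from T-∧ (x∈S , tt)

∈-─⁻ : ∀ (S : VSet m) → x ∈ₛ (S ─ a) → x ∈ₛ S × x ≢ a
∈-─⁻ {x = x} {a = a} S x∈ with x ≟ a
... | yes _ = ⊥-elim (proj₂ (to (T-∧ {S x}) x∈))
... | no x≢a = proj₁ (to (T-∧ {S x}) x∈) , x≢a

─-mono : S ⊆ₛ S' → (S ─ a) ⊆ₛ (S' ─ a)
─-mono {S = S} {S' = S'} S⊆S' x x∈ =
  let x∈S , x≢a = ∈-─⁻ S x∈ in ∈-─⁺ S' (S⊆S' x x∈S) x≢a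

∈-─³⁺ : ∀ (S : VSet m) → x ∈ₛ S → x ≢ a → x ≢ b → x ≢ d → x ∈ₛ (((S ─ a) ─ b) ─ d)
∈-─³⁺ {a = a} {b = b} S x∈S x≢a x≢b x≢d =
  ∈-─⁺ ((S ─ a) ─ b) (∈-─⁺ (S ─ a) (∈-─⁺ S x∈S x≢a) x≢b) x≢d

∈-─³⁻ : ∀ (S : VSet m) → x ∈ₛ (((S ─ a) ─ b) ─ d) → x ∈ₛ S × x ≢ a × x ≢ b × x ≢ d
∈-─³⁻ {a = a} {b = b} S x∈ =
  let x∈₂ , x≢d = ∈-─⁻ ((S ─ a) ─ b) x∈
      x∈₁ , x≢b = ∈-─⁻ (S ─ a) x∈₂
      x∈S , x≢a = ∈-─⁻ S x∈₁
  in x∈S , x≢a , x≢b , x≢d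

∈-∁⁺ : ∀ (S : VSet m) → ¬ x ∈ₛ S → x ∈ₛ ∁ S
∈-∁⁺ {x = x} S x∉S with S x
... | true = x∉S tt
... | false = tt

∈-∁⁻ : ∀ (S : VSet m) → x ∈ₛ ∁ S → ¬ x ∈ₛ S
∈-∁⁻ {x = x} S x∈∁S with S x
... | true = ⊥-elim x∈∁S
... | false = λ ()

∈-∪⁻ : ∀ (S S' : VSet m) x → x ∈ₛ (S ∪ S') → x ∈ₛ S ⊎ x ∈ₛ S'
∈-∪⁻ S _ x = to (T-∨ {S x})

∪-⊇ˡ : ∀ (S S' : VSet m) → S ⊆ₛ (S ∪ S')
∪-⊇ˡ _ _ x x∈S = from T-∨ (inj₁ x∈S)

∪-⊇ʳ : ∀ (S S' : VSet m) → S' ⊆ₛ (S ∪ S')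
∪-⊇ʳ S _ x x∈S' = from (T-∨ {S x}) (inj₂ x∈S')

tail : VSet (suc m) → VSet m
tail S x = S (Fin.suc x)

card-mono : ∀ (S S' : VSet m) → S ⊆ₛ S' → card S ≤ card S'
card-mono {zero} _ _ _ = z≤n
card-mono {suc m} S S' S⊆S' with S Fin.zero in eS | S' Fin.zero in eS'
... | true  | true  = s≤s (card-mono (tail S) (tail S') (λ x → S⊆S' (Fin.suc x)))
... | false | false = card-mono (tail S) (tail S') (λ x → S⊆S' (Fin.suc x))
... | false | true  = ≤-trans (card-mono (tail S) (tail S') (λ x → S⊆S' (Fin.suc x))) (n≤1+n _)
... | true  | false = ⊥-elim (subst T eS' (S⊆S' Fin.zero (subst T (sym eS) tt)))

card-∅ : card {m} (λ _ → false) ≡ 0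
card-∅ {zero} = refl
card-∅ {suc m} = card-∅ {m}

card-─ : ∀ (S : VSet m) a → card S ≤ suc (card (S ─ a))
card-─ {suc m} S Fin.zero with S Fin.zero
... | true  = s≤s (card-mono (tail S) (tail (S ─ Fin.zero)) λ x x∈ → from T-∧ (x∈ , tt))
... | false = ≤-trans (card-mono (tail S) (tail (S ─ Fin.zero)) λ x x∈ → from T-∧ (x∈ , tt)) (n≤1+n _)
card-─ {suc m} S (Fin.suc a) with S Fin.zero
... | true  = s≤s (card-─ (tail S) a)
... | false = card-─ (tail S) a

card-─-∈ : ∀ (S : VSet m) → a ∈ₛ S → suc (card (S ─ a)) ≤ card S
card-─-∈ {suc m} {Fin.zero} S a∈S with S Fin.zero
... | true = s≤s (card-mono (tail (S ─ Fin.zero)) (tail S) λ x x∈ → proj₁ (to (T-∧ {S (Fin.suc x)}) x∈))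
card-─-∈ {suc m} {Fin.suc a} S a∈S with S Fin.zero
... | true  = s≤s (card-─-∈ (tail S) a∈S)
... | false = card-─-∈ (tail S) a∈S

nonempty : ∀ (S : VSet m) → 0 < card S → ∃ λ x → x ∈ₛ S
nonempty {suc m} S 0<|S| with S Fin.zero in eS
... | true  = Fin.zero , subst T (sym eS) tt
... | false = let x , x∈ = nonempty (tail S) 0<|S| in Fin.suc x , x∈

nonempty-─ : ∀ (S : VSet m) a → 1 < card S → ∃ λ x → x ∈ₛ (S ─ a)
nonempty-─ S a 1<|S| = nonempty (S ─ a) (≤-pred (≤-trans 1<|S| (card-─ S a)))

nonempty-─³ : ∀ (S : VSet m) a b d → 3 < card S → ∃ λ x → x ∈ₛ (((S ─ a) ─ b) ─ d)
nonempty-─³ S a b d 3<|S| = nonempty (((S ─ a) ─ b) ─ d) (≤-pred (≤-pred (≤-pred (≤-trans 3<|S|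
  (≤-trans (card-─ S a) (s≤s (≤-trans (card-─ (S ─ a) b) (s≤s (card-─ ((S ─ a) ─ b) d)))))))))

sumFin-mono : ∀ (f g : Fin m → ℕ) → (∀ x → f x ≤ g x) → sumFin f ≤ sumFin g
sumFin-mono {zero} f g f≤g = z≤n
sumFin-mono {suc m} f g f≤g = +-mono-≤ (f≤g Fin.zero) (sumFin-mono _ _ (λ x → f≤g (Fin.suc x)))

sumFin-if : ∀ (S : VSet m) k → sumFin (λ x → if S x then k else 0) ≡ card S * k
sumFin-if {zero} S k = refl
sumFin-if {suc m} S k with S Fin.zero
... | true  = cong (k +_) (sumFin-if (tail S) k)
... | false = sumFin-if (tail S) k

edgeCountIn-≤ : ∀ (E : BGraph m) S → edgeCountIn E S ≤ card S * pred (card S)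
edgeCountIn-≤ {m} E S = ≤-trans (sumFin-mono _ _ row-≤) (≤-reflexive (sumFin-if S (pred (card S))))
  where
  row-≤ : ∀ x → card (λ y → S x ∧ S y ∧ E x y ∧ (toℕ x <ᵇ toℕ y)) ≤ (if S x then pred (card S) else 0)
  row-≤ x with S x in eS
  ... | false = ≤-reflexive (card-∅ {m})
  ... | true  = ≤-trans (card-mono later (S ─ x) later⊆) (<⇒≤pred (card-─-∈ S (subst T (sym eS) tt)))
    where
    later : VSet m
    later y = S y ∧ E x y ∧ (toℕ x <ᵇ toℕ y)

    later⊆ : later ⊆ₛ (S ─ x)
    later⊆ y y∈ =
      let y∈S , rest = to (T-∧ {S y}) y∈
      in ∈-─⁺ S y∈S λ { refl → n≮n (toℕ x) (<ᵇ⇒< (toℕ x) (toℕ x) (proj₂ (to (T-∧ {E x x}) rest))) }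

eightEdges⇒fourVertices : ∀ (E : BGraph m) S → 8 ≤ edgeCountIn E S → 4 ≤ card S
eightEdges⇒fourVertices E S 8≤|E| with 4 ≤? card S
... | yes 4≤|S| = 4≤|S|
... | no 4≰|S| =
  contradiction (≤-trans 8≤|E| (≤-trans (edgeCountIn-≤ E S) (*-mono-≤ |S|≤3 (pred-mono-≤ |S|≤3))))
                (toWitnessFalse {a? = 8 ≤? 6} tt)
  where
  |S|≤3 : card S ≤ 3
  |S|≤3 = ≤-pred (≰⇒> 4≰|S|)

module _ {k} {R : Fin k → Fin k → Set} where

  private variable
    P Q X Y : VSet k
    u v w : Fin k

  reach-start : ReachIn R P u v → u ∈ₛ P
  reach-start (here u∈P) = u∈P
  reach-start (step u∈P _ _) = u∈P

  reach-end : ReachIn R P u v → v ∈ₛ P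
  reach-end (here v∈P) = v∈P
  reach-end (step _ _ r) = reach-end r

  reach-trans : ReachIn R P u v → ReachIn R P v w → ReachIn R P u w
  reach-trans (here _) r' = r'
  reach-trans (step u∈P e r) r' = step u∈P e (reach-trans r r')

  reach-mono : P ⊆ₛ Q → ReachIn R P u v → ReachIn R Q u v
  reach-mono P⊆Q (here u∈P) = here (P⊆Q _ u∈P)
  reach-mono P⊆Q (step u∈P e r) = step (P⊆Q _ u∈P) e (reach-mono P⊆Q r)

  vertices : ReachIn R P u v → VSet k
  vertices (here {u} _) = single u
  vertices (step {u} _ _ r) = single u ∪ vertices r

  IsPath : ReachIn R P u v → Set
  IsPath (here _) = ⊤
  IsPath (step {u} _ _ r) = ¬ u ∈ₛ vertices r × IsPath r

  vertices-⊆ : (r : ReachIn R P u v) → vertices r ⊆ₛ P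
  vertices-⊆ (here {u} u∈P) x x∈ with refl ← T-does⁻ (x ≟ u) x∈ = u∈P
  vertices-⊆ (step {u} u∈P _ r) x x∈ with ∈-∪⁻ (single u) (vertices r) x x∈
  ... | inj₁ x∈u with refl ← T-does⁻ (x ≟ u) x∈u = u∈P
  ... | inj₂ x∈r = vertices-⊆ r x x∈r

  start∈vertices : (r : ReachIn R P u v) → u ∈ₛ vertices r
  start∈vertices (here {u} _) = T-does⁺ (u ≟ u) refl
  start∈vertices (step {u} _ _ r) = ∪-⊇ˡ (single u) (vertices r) u (T-does⁺ (u ≟ u) refl)

  tail⊆vertices : ∀ (u∈P : u ∈ₛ P) (e : R u w) (r : ReachIn R P w v) → vertices r ⊆ₛ vertices (step u∈P e r)
  tail⊆vertices {u = u} _ _ r = ∪-⊇ʳ (single u) (vertices r)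

  reach-end-within : (r : ReachIn R P u v) → w ∈ₛ vertices r → ReachIn R (vertices r) w v
  reach-end-within {w = w} (here {u} _) w∈ with refl ← T-does⁻ (w ≟ u) w∈ = here (T-does⁺ (u ≟ u) refl)
  reach-end-within {w = w} (step {u} u∈P e r) w∈ with ∈-∪⁻ (single u) (vertices r) w w∈
  ... | inj₁ w∈u with refl ← T-does⁻ (w ≟ u) w∈u =
    step (start∈vertices (step u∈P e r)) e
         (reach-mono (tail⊆vertices u∈P e r) (reach-end-within r (start∈vertices r)))
  ... | inj₂ w∈r = reach-mono (tail⊆vertices u∈P e r) (reach-end-within r w∈r)

  suffix : (r : ReachIn R P u v) → IsPath r → w ∈ₛ vertices r → ∃ λ (r' : ReachIn R P w v) → IsPath r'
  suffix {w = w} (here {u} u∈P) _ w∈ with refl ← T-does⁻ (w ≟ u) w∈ = here u∈P , tt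
  suffix {w = w} (step {u} u∈P e r) (u∉r , r-path) w∈ with ∈-∪⁻ (single u) (vertices r) w w∈
  ... | inj₁ w∈u with refl ← T-does⁻ (w ≟ u) w∈u = step u∈P e r , u∉r , r-path
  ... | inj₂ w∈r = suffix r r-path w∈r

  toPath : ReachIn R P u v → ∃ λ (r : ReachIn R P u v) → IsPath r
  toPath (here u∈P) = here u∈P , tt
  toPath (step {u} u∈P e r) with toPath r
  ... | r' , r'-path with T? (vertices r' u)
  ...   | yes u∈r' = suffix r' r'-path u∈r'
  ...   | no u∉r' = step u∈P e r' , u∉r' , r'-path

  module _ (R-sym : ∀ {u v} → R u v → R v u) where

    reach-sym : ReachIn R P u v → ReachIn R P v u
    reach-sym (here u∈P) = here u∈P
    reach-sym (step u∈P e r) = reach-trans (reach-sym r) (step (reach-start r) (R-sym e) (here u∈P))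

    connected-via : X ⊆ₛ Y → ConnectedIn R X → (∀ y → y ∈ₛ Y → ∃ λ x → x ∈ₛ X × ReachIn R Y y x) →
                    ConnectedIn R Y
    connected-via X⊆Y X-conn to-X y₁ y₂ y₁∈Y y₂∈Y =
      let x₁ , x₁∈X , y₁↝x₁ = to-X y₁ y₁∈Y
          x₂ , x₂∈X , y₂↝x₂ = to-X y₂ y₂∈Y
      in reach-trans y₁↝x₁ (reach-trans (reach-mono X⊆Y (X-conn x₁ x₂ x₁∈X x₂∈X)) (reach-sym y₂↝x₂))

    reach-start-within : (r : ReachIn R P u v) → w ∈ₛ vertices r → ReachIn R (vertices r) w u
    reach-start-within r w∈ =
      reach-trans (reach-end-within r w∈) (reach-sym (reach-end-within r (start∈vertices r)))

    path-split : (r : ReachIn R P u v) → IsPath r → w ∈ₛ vertices r → w ≢ z →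
                 ReachIn R (vertices r ─ z) w u ⊎ ReachIn R (vertices r ─ z) w v
    path-split {w = w} (here {u} _) _ w∈ w≢z with refl ← T-does⁻ (w ≟ u) w∈ =
      inj₁ (here (∈-─⁺ (single u) (T-does⁺ (u ≟ u) refl) w≢z))
    path-split {w = w} {z = z} (step {u} u∈P e r) (u∉r , r-path) w∈ w≢z
      with ∈-∪⁻ (single u) (vertices r) w w∈
    ... | inj₁ w∈u with refl ← T-does⁻ (w ≟ u) w∈u =
      inj₁ (here (∈-─⁺ (vertices (step u∈P e r)) (start∈vertices (step u∈P e r)) w≢z))
    ... | inj₂ w∈r with z ≟ u
    ...   | yes refl = inj₂ (reach-mono r⊆ (reach-end-within r w∈r))
      where
      r⊆ : vertices r ⊆ₛ (vertices (step u∈P e r) ─ z)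
      r⊆ x x∈r = ∈-─⁺ (vertices (step u∈P e r)) (tail⊆vertices u∈P e r x x∈r) λ { refl → u∉r x∈r }
    ...   | no z≢u with path-split r r-path w∈r w≢z
    ...     | inj₂ w↝v = inj₂ (reach-mono r⊆ w↝v)
      where r⊆ = ─-mono (tail⊆vertices u∈P e r)
    ...     | inj₁ w↝u' =
      inj₁ (reach-trans (reach-mono r⊆ w↝u') (step (r⊆ _ (reach-end w↝u')) (R-sym e) (here u∈r─z)))
      where
      r⊆ = ─-mono (tail⊆vertices u∈P e r)
      u∈r─z = ∈-─⁺ (vertices (step u∈P e r)) (start∈vertices (step u∈P e r)) (≢-sym z≢u)

-- Ears of two-node-connected sets

module _ {k} {R : Fin k → Fin k → Set} (R-sym : ∀ {u v} → R u v → R v u) {S : VSet k} {A D B B' : Fin k}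
         (A∈S : A ∈ₛ S) (D∈S : D ∈ₛ S) (A≢D : A ≢ D) (A~B : R A B) (B'~D : R B' D) where

  private
    ↝B⇒↝A : ∀ {X x} → ReachIn R X x B → A ∈ₛ X → ReachIn R X x A
    ↝B⇒↝A x↝B A∈X = reach-trans x↝B (step (reach-end x↝B) (R-sym A~B) (here A∈X))

    ↝B'⇒↝D : ∀ {X x} → ReachIn R X x B' → D ∈ₛ X → ReachIn R X x D
    ↝B'⇒↝D x↝B' D∈X = reach-trans x↝B' (step (reach-end x↝B') B'~D (here D∈X))

  module _ (S-2conn : TwoNodeConnected R S) (p : ReachIn R (∁ S) B B') (p-path : IsPath p) where

    private
      S⁺ : VSet k
      S⁺ = S ∪ vertices p

      S⊆S⁺ : S ⊆ₛ S⁺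
      S⊆S⁺ = ∪-⊇ˡ S (vertices p)

      p⊆S⁺ : vertices p ⊆ₛ S⁺
      p⊆S⁺ = ∪-⊇ʳ S (vertices p)

      S-connected : ConnectedIn R S
      S-connected = proj₁ (proj₂ S-2conn)

    ear-connected : ConnectedIn R (S ∪ vertices p)
    ear-connected = connected-via R-sym S⊆S⁺ S-connected to-S
      where
      to-S : ∀ y → y ∈ₛ S⁺ → ∃ λ x → x ∈ₛ S × ReachIn R S⁺ y x
      to-S y y∈ with ∈-∪⁻ S (vertices p) y y∈
      ... | inj₁ y∈S = y , y∈S , here y∈
      ... | inj₂ y∈p = D , D∈S , ↝B'⇒↝D (reach-mono p⊆S⁺ (reach-end-within p y∈p)) (S⊆S⁺ D D∈S)

    -- Removing z ∈ S leaves the ear intact, attached to whichever of A and D survives.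
    ear-─-inside : ∀ z → z ∈ₛ S → ConnectedIn R ((S ∪ vertices p) ─ z)
    ear-─-inside z z∈S = connected-via R-sym (─-mono S⊆S⁺) (proj₂ (proj₂ S-2conn) z z∈S) to-S─z
      where
      p⊆S⁺─z : vertices p ⊆ₛ (S⁺ ─ z)
      p⊆S⁺─z x x∈p = ∈-─⁺ S⁺ (p⊆S⁺ x x∈p) λ { refl → ∈-∁⁻ S (vertices-⊆ p x x∈p) z∈S }

      to-S─z : ∀ y → y ∈ₛ (S⁺ ─ z) → ∃ λ x → x ∈ₛ (S ─ z) × ReachIn R (S⁺ ─ z) y x
      to-S─z y y∈ with ∈-─⁻ S⁺ y∈
      ... | y∈S⁺ , y≢z with ∈-∪⁻ S (vertices p) y y∈S⁺ | A ≟ z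
      ...   | inj₁ y∈S | _ = y , ∈-─⁺ S y∈S y≢z , here y∈
      ...   | inj₂ y∈p | yes refl =
        D , D∈S─z , ↝B'⇒↝D (reach-mono p⊆S⁺─z (reach-end-within p y∈p)) (─-mono S⊆S⁺ D D∈S─z)
        where D∈S─z = ∈-─⁺ S D∈S (≢-sym A≢D)
      ...   | inj₂ y∈p | no A≢z =
        A , A∈S─z , ↝B⇒↝A (reach-mono p⊆S⁺─z (reach-start-within R-sym p y∈p)) (─-mono S⊆S⁺ A A∈S─z)
        where A∈S─z = ∈-─⁺ S A∈S A≢z

    ear-─-outside : ∀ z → ¬ z ∈ₛ S → ConnectedIn R ((S ∪ vertices p) ─ z)
    ear-─-outside z z∉S = connected-via R-sym S⊆S⁺─z S-connected to-S
      where
      S⊆S⁺─z : S ⊆ₛ (S⁺ ─ z)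
      S⊆S⁺─z x x∈S = ∈-─⁺ S⁺ (S⊆S⁺ x x∈S) λ { refl → z∉S x∈S }

      to-S : ∀ y → y ∈ₛ (S⁺ ─ z) → ∃ λ x → x ∈ₛ S × ReachIn R (S⁺ ─ z) y x
      to-S y y∈ with ∈-─⁻ S⁺ y∈
      ... | y∈S⁺ , y≢z with ∈-∪⁻ S (vertices p) y y∈S⁺
      ...   | inj₁ y∈S = y , y∈S , here y∈
      ...   | inj₂ y∈p with path-split R-sym p p-path y∈p y≢z
      ...     | inj₁ y↝B = A , A∈S , ↝B⇒↝A (reach-mono (─-mono p⊆S⁺) y↝B) (S⊆S⁺─z A A∈S)
      ...     | inj₂ y↝B' = D , D∈S , ↝B'⇒↝D (reach-mono (─-mono p⊆S⁺) y↝B') (S⊆S⁺─z D D∈S)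

    ear-twoNodeConnected : TwoNodeConnected R (S ∪ vertices p)
    ear-twoNodeConnected = ≤-trans (proj₁ S-2conn) (card-mono S S⁺ S⊆S⁺) , ear-connected , ear-─
      where
      ear-─ : ∀ z → z ∈ₛ S⁺ → ConnectedIn R (S⁺ ─ z)
      ear-─ z _ with T? (S z)
      ... | yes z∈S = ear-─-inside z z∈S
      ... | no z∉S = ear-─-outside z z∉S

  segment-no-ear : NonTrivialSegment R S → ReachIn R (∁ S) B B' → ⊥
  segment-no-ear (S-2conn , S-max) q =
    let p , p-path = toPath q
    in ∈-∁⁻ S (reach-start p)
         (S-max (S ∪ vertices p) (∪-⊇ˡ S (vertices p)) (ear-twoNodeConnected S-2conn p p-path)
                B (∪-⊇ʳ S (vertices p) B (start∈vertices p)))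

-- Matchings of size three in bipartite graphs

IsMatching3 : ∀ {V : Set} → (V → V → Set) → (Fin 3 → V) → (Fin 3 → V) → Set
IsMatching3 E u v =
  (∀ i → E (u i) (v i)) ×
  (∀ i j → i ≢ j → u i ≢ u j × v i ≢ v j × u i ≢ v j) ×
  (∀ i → u i ≢ v i)

IsMatching3-mono : ∀ {V : Set} {E F : V → V → Set} {u v} → (∀ {x y} → E x y → F x y) →
                   IsMatching3 E u v → IsMatching3 F u v
IsMatching3-mono E⇒F (edges , distinct , loopless) = (λ i → E⇒F (edges i)) , distinct , loopless

EdgeAvoiding : ∀ {V : Set} → (V → V → Set) → V → V → Set
EdgeAvoiding E z₁ z₂ = ∃₂ λ x y → E x y × x ≢ z₁ × x ≢ z₂ × y ≢ z₁ × y ≢ z₂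

NoTwoVertexCover : ∀ {V : Set} → (V → V → Set) → Set
NoTwoVertexCover E = ∀ z₁ z₂ → EdgeAvoiding E z₁ z₂

module _ {V : Set} (_≟ᵥ_ : DecidableEquality V) {E : V → V → Set}
         (bipartite : ∀ {x y x' y'} → E x y → E x' y' → x ≢ y') where

  private
    lookup-injective₃ : ∀ {x₁ x₂ x₃ : V} → x₁ ≢ x₂ → x₁ ≢ x₃ → x₂ ≢ x₃ →
                        ∀ i j → i ≢ j → lookup (x₁ ∷ x₂ ∷ x₃ ∷ []) i ≢ lookup (x₁ ∷ x₂ ∷ x₃ ∷ []) j
    lookup-injective₃ _   _   _   0F 0F 0≢0 = contradiction refl 0≢0
    lookup-injective₃ 1≢2 _   _   0F 1F _   = 1≢2
    lookup-injective₃ _   1≢3 _   0F 2F _   = 1≢3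
    lookup-injective₃ 1≢2 _   _   1F 0F _   = ≢-sym 1≢2
    lookup-injective₃ _   _   _   1F 1F 1≢1 = contradiction refl 1≢1
    lookup-injective₃ _   _   2≢3 1F 2F _   = 2≢3
    lookup-injective₃ _   1≢3 _   2F 0F _   = ≢-sym 1≢3
    lookup-injective₃ _   _   2≢3 2F 1F _   = ≢-sym 2≢3
    lookup-injective₃ _   _   _   2F 2F 2≢2 = contradiction refl 2≢2

  matching3-of-disjoint : ∀ {a₁ b₁ a₂ b₂ a₃ b₃} → E a₁ b₁ → E a₂ b₂ → E a₃ b₃ →
                          a₁ ≢ a₂ → a₁ ≢ a₃ → a₂ ≢ a₃ → b₁ ≢ b₂ → b₁ ≢ b₃ → b₂ ≢ b₃ → ∃₂ (IsMatching3 E)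
  matching3-of-disjoint {a₁} {b₁} {a₂} {b₂} {a₃} {b₃} e₁ e₂ e₃ a₁≢a₂ a₁≢a₃ a₂≢a₃ b₁≢b₂ b₁≢b₃ b₂≢b₃ =
    u , v , edges , (λ i j i≢j → lookup-injective₃ a₁≢a₂ a₁≢a₃ a₂≢a₃ i j i≢j ,
                                 lookup-injective₃ b₁≢b₂ b₁≢b₃ b₂≢b₃ i j i≢j ,
                                 bipartite (edges i) (edges j)) ,
    (λ i → bipartite (edges i) (edges i))
    where
    u v : Fin 3 → V
    u = lookup (a₁ ∷ a₂ ∷ a₃ ∷ [])
    v = lookup (b₁ ∷ b₂ ∷ b₃ ∷ [])

    edges : ∀ i → E (u i) (v i)
    edges 0F = e₁
    edges 1F = e₂
    edges 2F = e₃

  matching3-via-a₁ : ∀ {a₁ b₁ a₂ b₂ y x b s t} → E a₁ b₁ → E a₂ b₂ → a₁ ≢ a₂ → b₁ ≢ b₂ →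
                     E a₁ y → y ≢ b₁ → y ≢ b₂ → E x b → x ≢ a₁ → x ≢ a₂ → E s t → s ≢ a₁ → t ≢ b₂ →
                     ∃₂ (IsMatching3 E)
  matching3-via-a₁ {a₁} {b₁} {a₂} {b₂} {y} {x} {b} {s} {t}
                   e₁ e₂ a₁≢a₂ b₁≢b₂ f y≢b₁ y≢b₂ g x≢a₁ x≢a₂ h s≢a₁ t≢b₂ with b ≟ᵥ b₁ | b ≟ᵥ b₂
  ... | yes refl | _ = matching3-of-disjoint f g e₂ (≢-sym x≢a₁) a₁≢a₂ x≢a₂ y≢b₁ y≢b₂ b₁≢b₂
  ... | no b≢b₁ | no b≢b₂ =
    matching3-of-disjoint e₁ e₂ g a₁≢a₂ (≢-sym x≢a₁) (≢-sym x≢a₂) b₁≢b₂ (≢-sym b≢b₁) (≢-sym b≢b₂)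
  ... | no _ | yes refl with s ≟ᵥ a₂ | t ≟ᵥ b₁
  ...   | yes refl | yes refl =
    matching3-of-disjoint f h g a₁≢a₂ (≢-sym x≢a₁) (≢-sym x≢a₂) y≢b₁ y≢b₂ b₁≢b₂
  ...   | yes refl | no t≢b₁ =
    matching3-of-disjoint h e₁ g (≢-sym a₁≢a₂) (≢-sym x≢a₂) (≢-sym x≢a₁) t≢b₁ t≢b₂ b₁≢b₂
  ...   | no s≢a₂ | yes refl =
    matching3-of-disjoint h e₂ f s≢a₂ s≢a₁ (≢-sym a₁≢a₂) b₁≢b₂ (≢-sym y≢b₁) (≢-sym y≢b₂)
  ...   | no s≢a₂ | no t≢b₁ =
    matching3-of-disjoint e₁ e₂ h a₁≢a₂ (≢-sym s≢a₁) (≢-sym s≢a₂) b₁≢b₂ (≢-sym t≢b₁) (≢-sym t≢b₂)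

  extend-2-matching : ∀ {a₁ b₁ a₂ b₂} → E a₁ b₁ → E a₂ b₂ → a₁ ≢ a₂ → b₁ ≢ b₂ →
                      EdgeAvoiding E b₁ b₂ → EdgeAvoiding E a₁ a₂ →
                      EdgeAvoiding E a₁ b₂ → EdgeAvoiding E a₂ b₁ → ∃₂ (IsMatching3 E)
  extend-2-matching {a₁} {b₁} {a₂} {b₂} e₁ e₂ a₁≢a₂ b₁≢b₂
                    (a , y , f , _ , _ , y≢b₁ , y≢b₂) (x , b , g , x≢a₁ , x≢a₂ , _)
                    (s₁ , t₁ , h₁ , s₁≢a₁ , _ , _ , t₁≢b₂) (s₂ , t₂ , h₂ , s₂≢a₂ , _ , _ , t₂≢b₁)
    with a ≟ᵥ a₁ | a ≟ᵥ a₂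
  ... | yes refl | _ = matching3-via-a₁ e₁ e₂ a₁≢a₂ b₁≢b₂ f y≢b₁ y≢b₂ g x≢a₁ x≢a₂ h₁ s₁≢a₁ t₁≢b₂
  ... | no _ | yes refl =
    matching3-via-a₁ e₂ e₁ (≢-sym a₁≢a₂) (≢-sym b₁≢b₂) f y≢b₂ y≢b₁ g x≢a₂ x≢a₁ h₂ s₂≢a₂ t₂≢b₁
  ... | no a≢a₁ | no a≢a₂ =
    matching3-of-disjoint e₁ e₂ f a₁≢a₂ (≢-sym a≢a₁) (≢-sym a≢a₂) b₁≢b₂ (≢-sym y≢b₁) (≢-sym y≢b₂)

  noTwoVertexCover⇒matching3 : V → NoTwoVertexCover E → ∃₂ (IsMatching3 E)
  noTwoVertexCover⇒matching3 v cover =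
    let a₁ , b₁ , e₁ , _ = cover v v
        a₂ , b₂ , e₂ , a₂≢a₁ , _ , _ , b₂≢b₁ = cover a₁ b₁
    in extend-2-matching e₁ e₂ (≢-sym a₂≢a₁) (≢-sym b₂≢b₁)
                         (cover b₁ b₂) (cover a₁ a₂) (cover a₁ b₂) (cover a₂ b₁)

connected-─-twice : ∀ {R : Fin m → Fin m → Set} (S : VSet m) a →
                    ConnectedIn R (S ─ a) → ConnectedIn R ((S ─ a) ─ a)
connected-─-twice S a S─a-conn x y x∈ y∈ =
  reach-mono (λ v v∈ → ∈-─⁺ (S ─ a) v∈ (proj₂ (∈-─⁻ S v∈)))
             (S─a-conn x y (proj₁ (∈-─⁻ (S ─ a) x∈)) (proj₁ (∈-─⁻ (S ─ a) y∈)))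

-- Doubly negated since connectivity is not decidable here; w is the vertex isolated by a 2-vertex cut.
¬¬-connected-─³ : ∀ {n} {G : BGraph n} → NoCutVertex G → NoNonIsolatingCut G →
                  ∀ z₁ z₂ → ¬ ¬ ∃ λ w → ConnectedIn (rel G) (((full ─ z₁) ─ z₂) ─ w)
¬¬-connected-─³ no-cut-vertex isolating z₁ z₂ none with z₁ ≟ z₂
... | yes refl = none (z₁ , connected-─-twice (full ─ z₁) z₁ (connected-─-twice full z₁ (no-cut-vertex z₁)))
... | no z₁≢z₂ = ¬¬-excluded-middle λ where
  (yes conn) → none (z₂ , connected-─-twice (full ─ z₁) z₂ conn)
  (no ¬conn) → let w , _ , _ , _ , _ , rest-conn , _ = isolating z₁ z₂ (z₁≢z₂ , ¬conn)
               in none (w , rest-conn)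

fibre : ∀ {n k} → (Fin n → Fin k) → Fin k → VSet n
fibre c B x = does (c x ≟ B)

fibre-meets-─³ : ∀ {n k} (c : Fin n → Fin k) C z₁ z₂ w → 3 < card (fibre c C) →
                 ∃ λ x → c x ≡ C × x ∈ₛ (((full ─ z₁) ─ z₂) ─ w)
fibre-meets-─³ c C z₁ z₂ w 3<|C| with nonempty-─³ (fibre c C) z₁ z₂ w 3<|C|
... | x , x∈ with ∈-─³⁻ (fibre c C) x∈
...   | x∈C , x≢z₁ , x≢z₂ , x≢w = x , T-does⁻ (c x ≟ C) x∈C , ∈-─³⁺ full tt x≢z₁ x≢z₂ x≢w

fibre-isComponent : ∀ {n k} {H : BGraph n} {c : Fin n → Fin k} → IsComponentLabelling H c →
                    ∀ B → IsComponent H (fibre c B)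
fibre-isComponent {H = H} {c} (surjective , same⇔reach) B =
  (x₀ , T-does⁺ (c x₀ ≟ B) cx₀≡B) , connected , closed
  where
  x₀ = proj₁ (surjective B)
  cx₀≡B = proj₂ (surjective B)

  closed : ∀ x y → x ∈ₛ fibre c B → T (H x y) → y ∈ₛ fibre c B
  closed x y x∈ xy∈H =
    T-does⁺ (c y ≟ B) (trans (sym (proj₂ (same⇔reach x y) (step tt xy∈H (here tt)))) (T-does⁻ (c x ≟ B) x∈))

  restrict : ∀ {x y} → ReachIn (rel H) full x y → x ∈ₛ fibre c B → ReachIn (rel H) (fibre c B) x y
  restrict (here _) x∈ = here x∈
  restrict (step _ xx'∈H r) x∈ = step x∈ xx'∈H (restrict r (closed _ _ x∈ xx'∈H))

  connected : ConnectedIn (rel H) (fibre c B)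
  connected x y x∈ y∈ =
    restrict (proj₁ (same⇔reach x y) (trans (T-does⁻ (c x ≟ B) x∈) (sym (T-does⁻ (c y ≟ B) y∈)))) x∈

canonical⇒4≤card : ∀ {n} {H : BGraph n} → Canonical H → ∀ C → IsComponent H C → 4 ≤ card C
canonical⇒4≤card {H = H} canonical C C-component with canonical C C-component
... | inj₁ (_ , 4≤|C| , _) = 4≤|C|
... | inj₂ 8≤|E| = eightEdges⇒fourVertices H C 8≤|E|

Exit : ∀ {n k} → BGraph n → (Fin n → Fin k) → VSet k → Fin k → Fin n → Fin n → Set
Exit G c S A x y = c x ≡ A × c y ∈ₛ S × c y ≢ A × T (G x y)

exit-bipartite : ∀ {n k} {G : BGraph n} {c : Fin n → Fin k} {S A x y x' y'} →
                 Exit G c S A x y → Exit G c S A x' y' → x ≢ y'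
exit-bipartite (cx≡A , _) (_ , _ , cy'≢A , _) refl = cy'≢A cx≡A

module ExitEdges {n k} {G : BGraph n} (G-sym : Symmetric G) {c : Fin n → Fin k} {S : VSet k}
         (segment : NonTrivialSegment (CompAdj G c) S) {A : Fin k} (A∈S : A ∈ₛ S) where

  private
    R = CompAdj G c

    R-sym : ∀ {B D} → R B D → R D B
    R-sym (B≢D , u , v , cu≡B , cv≡D , uv∈G) = ≢-sym B≢D , v , u , cv≡D , cu≡B , subst T (G-sym u v) uv∈G

  ReachableAvoidingS : Fin k → Set
  ReachableAvoidingS D = D ≡ A ⊎ ∃ λ B → R A B × ReachIn R (∁ S) B D

  reachable-∈S : ∀ {D} → ReachableAvoidingS D → D ∈ₛ S → D ≡ A
  reachable-∈S (inj₁ D≡A) _ = D≡A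
  reachable-∈S (inj₂ (_ , _ , q)) D∈S = ⊥-elim (∈-∁⁻ S (reach-end q) D∈S)

  -- Entering S at a node other than A after an excursion outside S would make the excursion an ear.
  reachable-step : ∀ {x y} → ReachableAvoidingS (c x) → T (G x y) →
                   Exit G c S A x y ⊎ ReachableAvoidingS (c y)
  reachable-step {x} {y} (inj₁ cx≡A) xy∈G with c y ≟ A | T? (S (c y))
  ... | yes cy≡A | _ = inj₂ (inj₁ cy≡A)
  ... | no cy≢A | yes cy∈S = inj₁ (cx≡A , cy∈S , cy≢A , xy∈G)
  ... | no cy≢A | no cy∉S =
    inj₂ (inj₂ (c y , (≢-sym cy≢A , x , y , cx≡A , refl , xy∈G) , here (∈-∁⁺ S cy∉S)))
  reachable-step {x} {y} (inj₂ (B , A~B , q)) xy∈G with c y ≟ c x | T? (S (c y))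
  ... | yes cy≡cx | _ = inj₂ (inj₂ (B , A~B , subst (ReachIn R (∁ S) B) (sym cy≡cx) q))
  ... | no cy≢cx | no cy∉S =
    inj₂ (inj₂ (B , A~B , reach-trans q (step (reach-end q) cx~cy (here (∈-∁⁺ S cy∉S)))))
    where cx~cy = ≢-sym cy≢cx , x , y , refl , refl , xy∈G
  ... | no cy≢cx | yes cy∈S with c y ≟ A
  ...   | yes cy≡A = inj₂ (inj₁ cy≡A)
  ...   | no cy≢A = ⊥-elim (segment-no-ear R-sym A∈S cy∈S (≢-sym cy≢A) A~B cx~cy segment q)
    where cx~cy = ≢-sym cy≢cx , x , y , refl , refl , xy∈G

  exit-on-walk : ∀ {Z x y} → ReachIn (rel G) Z x y → ReachableAvoidingS (c x) → c y ∈ₛ S → c y ≢ A →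
                 ∃₂ λ u v → u ∈ₛ Z × v ∈ₛ Z × Exit G c S A u v
  exit-on-walk (here _) reachable cy∈S cy≢A = ⊥-elim (cy≢A (reachable-∈S reachable cy∈S))
  exit-on-walk (step x∈Z xx'∈G r) reachable cy∈S cy≢A with reachable-step reachable xx'∈G
  ... | inj₁ exit = _ , _ , x∈Z , reach-start r , exit
  ... | inj₂ reachable' = exit-on-walk r reachable' cy∈S cy≢A

  exit-avoiding? : ∀ z₁ z₂ → Dec (EdgeAvoiding (Exit G c S A) z₁ z₂)
  exit-avoiding? z₁ z₂ = any? λ x → any? λ y →
    (c x ≟ A ×-dec T? (S (c y)) ×-dec ¬? (c y ≟ A) ×-dec T? (G x y)) ×-dec
    ¬? (x ≟ z₁) ×-dec ¬? (x ≟ z₂) ×-dec ¬? (y ≟ z₁) ×-dec ¬? (y ≟ z₂)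

  module _ {B : Fin k} (B∈S : B ∈ₛ S) (B≢A : B ≢ A)
           (3<|A| : 3 < card (fibre c A)) (3<|B| : 3 < card (fibre c B)) where

    exit-avoiding : ∀ {z₁ z₂ w} → ConnectedIn (rel G) (((full ─ z₁) ─ z₂) ─ w) →
                    EdgeAvoiding (Exit G c S A) z₁ z₂
    exit-avoiding {z₁} {z₂} {w} conn
      with fibre-meets-─³ c A z₁ z₂ w 3<|A| | fibre-meets-─³ c B z₁ z₂ w 3<|B|
    ... | x , cx≡A , x∈ | y , cy≡B , y∈
      with exit-on-walk (conn x y x∈ y∈) (inj₁ cx≡A) (subst (_∈ₛ S) (sym cy≡B) B∈S) (B≢A ∘ trans (sym cy≡B))
    ...   | u , v , u∈ , v∈ , exit with ∈-─³⁻ full u∈ | ∈-─³⁻ full v∈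
    ...     | _ , u≢z₁ , u≢z₂ , _ | _ , v≢z₁ , v≢z₂ , _ = u , v , exit , u≢z₁ , u≢z₂ , v≢z₁ , v≢z₂

    exits-noTwoVertexCover : NoCutVertex G → NoNonIsolatingCut G → NoTwoVertexCover (Exit G c S A)
    exits-noTwoVertexCover no-cut-vertex isolating z₁ z₂ =
      decidable-stable (exit-avoiding? z₁ z₂) λ none →
        ¬¬-connected-─³ no-cut-vertex isolating z₁ z₂ λ (w , conn) → none (exit-avoiding conn)


exit-matching : ∀ {n k} {G H : BGraph n} {c : Fin n → Fin k} {S : VSet k} {A : Fin k} →
                Symmetric G → NoCutVertex G → NoNonIsolatingCut G → Canonical H → IsComponentLabelling H c →
                NonTrivialSegment (CompAdj G c) S → A ∈ₛ S → ∃₂ (IsMatching3 (Exit G c S A))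
exit-matching {c = c} {S} {A} G-sym no-cut-vertex isolating canonical labelling segment A∈S
  with nonempty-─ S A (≤-trans (n≤1+n 2) (proj₁ (proj₁ segment)))
... | B , B∈S─A with ∈-─⁻ S B∈S─A
...   | B∈S , B≢A =
  noTwoVertexCover⇒matching3 _≟_ (exit-bipartite {S = S}) (proj₁ (proj₁ labelling A))
    (exits-noTwoVertexCover B∈S B≢A (3<card A) (3<card B) no-cut-vertex isolating)
  where
  open ExitEdges G-sym segment A∈S

  3<card : ∀ C → 3 < card (fibre c C)
  3<card C = canonical⇒4≤card canonical (fibre c C) (fibre-isComponent labelling C)

lemma6p13 : (p q : ℕ) → 0 < p → 24 * p ≤ q →
    (n : ℕ) (G : BGraph n) → Structured n p q G →
    (H : BGraph n) → TwoEdgeCover G H → Bridgeless H → Canonical H →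
    (k : ℕ) (c : Fin n → Fin k) → IsComponentLabelling H c →
    (S : VSet k) → NonTrivialSegment (CompAdj G c) S →
    (A : Fin k) → A ∈ₛ S →
    Σ (Fin 3 → Fin n) λ u → Σ (Fin 3 → Fin n) λ v →
      Matching3 G u v ×
      (∀ i → c (u i) ≡ A) × (∀ i → c (v i) ∈ₛ S × c (v i) ≢ A)
lemma6p13 _ _ _ _ n G ((G-sym , _) , _ , no-cut-vertex , _ , _ , _ , isolating , _) H _ _ canonical
          k c labelling S segment A A∈S =
  conclude (exit-matching G-sym no-cut-vertex isolating canonical labelling segment A∈S)
  where
  conclude : ∃₂ (IsMatching3 (Exit G c S A)) →
             Σ (Fin 3 → Fin n) λ u → Σ (Fin 3 → Fin n) λ v →
               Matching3 G u v × (∀ i → c (u i) ≡ A) × (∀ i → c (v i) ∈ₛ S × c (v i) ≢ A)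
  conclude (u , v , matching@(exits , _)) =
    u , v , IsMatching3-mono {E = Exit G c S A} {F = rel G} (λ (_ , _ , _ , uv∈G) → uv∈G) matching ,
    (λ i → proj₁ (exits i)) , (λ i → proj₁ (proj₂ (exits i)) , proj₁ (proj₂ (proj₂ (exits i))))
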